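{- Let $\mathcal{L}$ be a many-sorted language containing the sorts $\mathsf i$, $\mathsf{list}$ and the symbols $\mathit{nil}$, $\mathit{cons}$. Then \[ \mathrm{CA} + \mathrm{IND}(\forall_1(\mathcal{L})) \vdash \mathrm{IND}_2(\mathrm{Open}(\mathcal{L})). \]
   Context: Many-sorted first-order logic with equality; $\mathit{nil}:\mathsf{list}$, $\mathit{cons}:\mathsf{i}\times\mathsf{list}\to\mathsf{list}$. $\mathrm{CA}$ is the sentence $\forall X\,(X=\mathit{nil}\vee\exists X'\,\exists x'\,X=\mathit{cons}(x',X'))$. For a formula $\varphi(X,\vec z)$, $I_X\varphi$ is $\big(\varphi(\mathit{nil},\vec z)\wedge\forall X\,\forall x\,(\varphi(X,\vec z)\rightarrow\varphi(\mathit{cons}(x,X),\vec z))\big)\rightarrow\forall X\,\varphi(X,\vec z)$; $\mathrm{IND}(\Phi)$ is axiomatized by the universal closures of $I_X\varphi$ for $\varphi\in\Phi$. For $\varphi(X,Y,\vec z)$, the double induction axiom $I_{X,Y}\varphi$ is \[ \Big(\forall X\,\varphi(X,\mathit{nil},\vec z)\wedge\forall Y\,\varphi(\mathit{nil},Y,\vec z)\wedge\forall X\,\forall Y\,\forall x\,\forall y\,\big(\varphi(X,Y,\vec z)\rightarrow\varphi(\mathit{cons}(x,X),\mathit{cons}(y,Y),\vec z)\big)\Big)\rightarrow\forall X\,\forall Y\,\varphi(X,Y,\vec z), \] and $\mathrm{IND}_2(\Gamma)$ is axiomatized by $\forall\vec z\,I_{X,Y}\varphi$ for $\varphi\in\Gamma$.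 $\mathrm{Open}(\mathcal L)$ is the set of quantifier-free $\mathcal L$-formulas; $\forall_1(\mathcal L)$ is the set of $\mathcal L$-formulas of the form $\forall\vec x\,\psi$ with $\psi$ quantifier-free and $\vec x$ a possibly empty sequence of variables. -}

module Defs where

open import Data.List using (List; []; _∷_; map)
open import Data.List.Membership.Propositional using (_∈_)
open import Relation.Binary.PropositionalEquality using (_≡_)
open import Relation.Nullary using (¬_)
open import Data.Sum using (_⊎_)
open import Data.Product using (Σ; _×_)

record Language : Set₁ where
  field
    Sort   : Set
    Fun    : List Sort → Sort → Set
    Rel    : List Sort → Set
    ι      : Sort
    𝕃      : Sort
    ι≢𝕃    : ¬ (ι ≡ 𝕃)
    nil    : Fun [] 𝕃
    cons   : Fun (ι ∷ 𝕃 ∷ []) 𝕃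

module FOL (L : Language) where
  open Language L

  -- typed de Bruijn variables; a context is a list of sorts, index 0 = head
  data Var : List Sort → Sort → Set where
    here  : ∀ {Γ s} → Var (s ∷ Γ) s
    there : ∀ {Γ s r} → Var Γ s → Var (r ∷ Γ) s

  mutual
    data Term (Γ : List Sort) : Sort → Set where
      var : ∀ {s} → Var Γ s → Term Γ s
      app : ∀ {ss s} → Fun ss s → Terms Γ ss → Term Γ s

    data Terms (Γ : List Sort) : List Sort → Set where
      []ₜ  : Terms Γ []
      _∷ₜ_ : ∀ {s ss} → Term Γ s → Terms Γ ss → Terms Γ (s ∷ ss)

  infixr 5 _∷ₜ_
  infix  7 _≐_
  infixr 6 _∧'_
  infixr 5 _∨'_
  infixr 4 _⇒_

  data Formula (Γ : List Sort) : Set where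
    ⊥'   : Formula Γ
    rel  : ∀ {ss} → Rel ss → Terms Γ ss → Formula Γ
    _≐_  : ∀ {s} → Term Γ s → Term Γ s → Formula Γ
    _⇒_  : Formula Γ → Formula Γ → Formula Γ
    _∧'_ : Formula Γ → Formula Γ → Formula Γ
    _∨'_ : Formula Γ → Formula Γ → Formula Γ
    ∀'   : (s : Sort) → Formula (s ∷ Γ) → Formula Γ
    ∃'   : (s : Sort) → Formula (s ∷ Γ) → Formula Γ

  ¬' : ∀ {Γ} → Formula Γ → Formula Γ
  ¬' φ = φ ⇒ ⊥'

  Ren : List Sort → List Sort → Set
  Ren Γ Δ = ∀ {s} → Var Γ s → Var Δ s

  liftR : ∀ {Γ Δ r} → Ren Γ Δ → Ren (r ∷ Γ) (r ∷ Δ)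
  liftR ρ here      = here
  liftR ρ (there v) = there (ρ v)

  mutual
    renT : ∀ {Γ Δ s} → Ren Γ Δ → Term Γ s → Term Δ s
    renT ρ (var v)    = var (ρ v)
    renT ρ (app f ts) = app f (renTs ρ ts)

    renTs : ∀ {Γ Δ ss} → Ren Γ Δ → Terms Γ ss → Terms Δ ss
    renTs ρ []ₜ       = []ₜ
    renTs ρ (t ∷ₜ ts) = renT ρ t ∷ₜ renTs ρ ts

  renF : ∀ {Γ Δ} → Ren Γ Δ → Formula Γ → Formula Δ
  renF ρ ⊥'         = ⊥'
  renF ρ (rel R ts) = rel R (renTs ρ ts)
  renF ρ (t ≐ u)    = renT ρ t ≐ renT ρ u
  renF ρ (φ ⇒ ψ)    = renF ρ φ ⇒ renF ρ ψ
  renF ρ (φ ∧' ψ)   = renF ρ φ ∧' renF ρ ψ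
  renF ρ (φ ∨' ψ)   = renF ρ φ ∨' renF ρ ψ
  renF ρ (∀' s φ)   = ∀' s (renF (liftR ρ) φ)
  renF ρ (∃' s φ)   = ∃' s (renF (liftR ρ) φ)

  Sub : List Sort → List Sort → Set
  Sub Γ Δ = ∀ {s} → Var Γ s → Term Δ s

  liftS : ∀ {Γ Δ r} → Sub Γ Δ → Sub (r ∷ Γ) (r ∷ Δ)
  liftS σ here      = var here
  liftS σ (there v) = renT there (σ v)

  mutual
    subT : ∀ {Γ Δ s} → Sub Γ Δ → Term Γ s → Term Δ s
    subT σ (var v)    = σ v
    subT σ (app f ts) = app f (subTs σ ts)

    subTs : ∀ {Γ Δ ss} → Sub Γ Δ → Terms Γ ss → Terms Δ ss
    subTs σ []ₜ       = []ₜ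
    subTs σ (t ∷ₜ ts) = subT σ t ∷ₜ subTs σ ts

  subF : ∀ {Γ Δ} → Sub Γ Δ → Formula Γ → Formula Δ
  subF σ ⊥'         = ⊥'
  subF σ (rel R ts) = rel R (subTs σ ts)
  subF σ (t ≐ u)    = subT σ t ≐ subT σ u
  subF σ (φ ⇒ ψ)    = subF σ φ ⇒ subF σ ψ
  subF σ (φ ∧' ψ)   = subF σ φ ∧' subF σ ψ
  subF σ (φ ∨' ψ)   = subF σ φ ∨' subF σ ψ
  subF σ (∀' s φ)   = ∀' s (subF (liftS σ) φ)
  subF σ (∃' s φ)   = ∃' s (subF (liftS σ) φ)

  sub0 : ∀ {Γ s} → Term Γ s → Sub (s ∷ Γ) Γ
  sub0 t here      = t
  sub0 t (there v) = var v

  _[_] : ∀ {Γ s} → Formula (s ∷ Γ) → Term Γ s → Formula Γ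
  φ [ t ] = subF (sub0 t) φ

  wk : ∀ {Γ s} → Formula Γ → Formula (s ∷ Γ)
  wk = renF there

  fromClosed : ∀ {Γ} → Formula [] → Formula Γ
  fromClosed = renF (λ ())

  -- universal closure: close (z₁ ∷ … ∷ zₙ) φ = ∀zₙ … ∀z₁ φ
  close : (Γ : List Sort) → Formula Γ → Formula []
  close []      φ = φ
  close (s ∷ Γ) φ = close Γ (∀' s φ)

  data IsOpen {Γ : List Sort} : Formula Γ → Set where
    ⊥'   : IsOpen ⊥'
    rel  : ∀ {ss} (R : Rel ss) (ts : Terms Γ ss) → IsOpen (rel R ts)
    _≐_  : ∀ {s} (t u : Term Γ s) → IsOpen (t ≐ u)
    _⇒_  : ∀ {φ ψ} → IsOpen φ → IsOpen ψ → IsOpen (φ ⇒ ψ)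
    _∧'_ : ∀ {φ ψ} → IsOpen φ → IsOpen ψ → IsOpen (φ ∧' ψ)
    _∨'_ : ∀ {φ ψ} → IsOpen φ → IsOpen ψ → IsOpen (φ ∨' ψ)

  data IsForall₁ : ∀ {Γ} → Formula Γ → Set where
    open' : ∀ {Γ} {φ : Formula Γ} → IsOpen φ → IsForall₁ φ
    all   : ∀ {Γ s} {φ : Formula (s ∷ Γ)} → IsForall₁ φ → IsForall₁ (∀' s φ)

  nilT : ∀ {Γ} → Term Γ 𝕃
  nilT = app nil []ₜ

  consT : ∀ {Γ} → Term Γ ι → Term Γ 𝕃 → Term Γ 𝕃
  consT x X = app cons (x ∷ₜ X ∷ₜ []ₜ)

  CA : Formula []
  CA = ∀' 𝕃 (var here ≐ nilT ∨'
             ∃' 𝕃 (∃' ι (var (there (there here)) ≐ consT (var here) (var (there here)))))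

  -- I_X φ for φ(X, z⃗) : Formula (𝕃 ∷ Γ)  (X is variable 0, z⃗ = Γ)
  σcons : ∀ {Γ} → Sub (𝕃 ∷ Γ) (ι ∷ 𝕃 ∷ Γ)
  σcons here      = consT (var here) (var (there here))
  σcons (there v) = var (there (there v))

  IX : ∀ {Γ} → Formula (𝕃 ∷ Γ) → Formula Γ
  IX φ = (φ [ nilT ] ∧' ∀' 𝕃 (∀' ι (renF there φ ⇒ subF σcons φ))) ⇒ ∀' 𝕃 φ

  -- I_{X,Y} φ for φ(X, Y, z⃗) : Formula (𝕃 ∷ 𝕃 ∷ Γ)
  -- (Y is variable 0, X is variable 1, z⃗ = Γ; so ∀' 𝕃 (∀' 𝕃 φ) is ∀X ∀Y φ)
  σYnil : ∀ {Γ} → Sub (𝕃 ∷ 𝕃 ∷ Γ) (𝕃 ∷ Γ)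
  σYnil here              = nilT
  σYnil (there here)      = var here
  σYnil (there (there v)) = var (there v)

  σXnil : ∀ {Γ} → Sub (𝕃 ∷ 𝕃 ∷ Γ) (𝕃 ∷ Γ)
  σXnil here              = var here
  σXnil (there here)      = nilT
  σXnil (there (there v)) = var (there v)

  -- target context: y ∷ x ∷ Y ∷ X ∷ Γ  (binders ∀X ∀Y ∀x ∀y)
  ρXY : ∀ {Γ} → Ren (𝕃 ∷ 𝕃 ∷ Γ) (ι ∷ ι ∷ 𝕃 ∷ 𝕃 ∷ Γ)
  ρXY v = there (there v)

  σconsXY : ∀ {Γ} → Sub (𝕃 ∷ 𝕃 ∷ Γ) (ι ∷ ι ∷ 𝕃 ∷ 𝕃 ∷ Γ)
  σconsXY here              = consT (var here) (var (there (there here)))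
  σconsXY (there here)      = consT (var (there here)) (var (there (there (there here))))
  σconsXY (there (there v)) = var (there (there (there (there v))))

  IXY : ∀ {Γ} → Formula (𝕃 ∷ 𝕃 ∷ Γ) → Formula Γ
  IXY φ = (∀' 𝕃 (subF σYnil φ)
           ∧' ∀' 𝕃 (subF σXnil φ)
           ∧' ∀' 𝕃 (∀' 𝕃 (∀' ι (∀' ι (renF ρXY φ ⇒ subF σconsXY φ)))))
          ⇒ ∀' 𝕃 (∀' 𝕃 φ)

  Theory : Set₁
  Theory = Formula [] → Set

  Class : Set₁
  Class = ∀ {Γ} → Formula Γ → Set

  IND : Class → Theory
  IND Φ ψ = Σ (List Sort) λ Γ → Σ (Formula (𝕃 ∷ Γ)) λ φ → Φ φ × (ψ ≡ close Γ (IX φ))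

  IND₂ : Class → Theory
  IND₂ Φ ψ = Σ (List Sort) λ Γ → Σ (Formula (𝕃 ∷ 𝕃 ∷ Γ)) λ φ → Φ φ × (ψ ≡ close Γ (IXY φ))

  _+_ : Theory → Theory → Theory
  (T + U) ψ = T ψ ⊎ U ψ

  ⟨_⟩ : Formula [] → Theory
  ⟨ χ ⟩ ψ = ψ ≡ χ

  -- classical natural deduction for many-sorted FOL with equality;
  -- T ∣ Γ ∣ Δ ⊢ φ : from axioms T and hypotheses Δ, φ is derivable
  -- (free variables from context Γ)
  data _∣_∣_⊢_ (T : Theory) : (Γ : List Sort) → List (Formula Γ) → Formula Γ → Set where
    ax    : ∀ {Γ Δ ψ} → T ψ → T ∣ Γ ∣ Δ ⊢ fromClosed ψ
    hyp   : ∀ {Γ Δ φ} → φ ∈ Δ → T ∣ Γ ∣ Δ ⊢ φ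
    ⊥E    : ∀ {Γ Δ φ} → T ∣ Γ ∣ Δ ⊢ ⊥' → T ∣ Γ ∣ Δ ⊢ φ
    raa   : ∀ {Γ Δ φ} → T ∣ Γ ∣ (¬' φ ∷ Δ) ⊢ ⊥' → T ∣ Γ ∣ Δ ⊢ φ
    ⇒I    : ∀ {Γ Δ φ ψ} → T ∣ Γ ∣ (φ ∷ Δ) ⊢ ψ → T ∣ Γ ∣ Δ ⊢ (φ ⇒ ψ)
    ⇒E    : ∀ {Γ Δ φ ψ} → T ∣ Γ ∣ Δ ⊢ (φ ⇒ ψ) → T ∣ Γ ∣ Δ ⊢ φ → T ∣ Γ ∣ Δ ⊢ ψ
    ∧I    : ∀ {Γ Δ φ ψ} → T ∣ Γ ∣ Δ ⊢ φ → T ∣ Γ ∣ Δ ⊢ ψ → T ∣ Γ ∣ Δ ⊢ (φ ∧' ψ)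
    ∧E₁   : ∀ {Γ Δ φ ψ} → T ∣ Γ ∣ Δ ⊢ (φ ∧' ψ) → T ∣ Γ ∣ Δ ⊢ φ
    ∧E₂   : ∀ {Γ Δ φ ψ} → T ∣ Γ ∣ Δ ⊢ (φ ∧' ψ) → T ∣ Γ ∣ Δ ⊢ ψ
    ∨I₁   : ∀ {Γ Δ φ ψ} → T ∣ Γ ∣ Δ ⊢ φ → T ∣ Γ ∣ Δ ⊢ (φ ∨' ψ)
    ∨I₂   : ∀ {Γ Δ φ ψ} → T ∣ Γ ∣ Δ ⊢ ψ → T ∣ Γ ∣ Δ ⊢ (φ ∨' ψ)
    ∨E    : ∀ {Γ Δ φ ψ χ} → T ∣ Γ ∣ Δ ⊢ (φ ∨' ψ) → T ∣ Γ ∣ (φ ∷ Δ) ⊢ χ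
            → T ∣ Γ ∣ (ψ ∷ Δ) ⊢ χ → T ∣ Γ ∣ Δ ⊢ χ
    ∀I    : ∀ {Γ Δ s φ} → T ∣ (s ∷ Γ) ∣ map wk Δ ⊢ φ → T ∣ Γ ∣ Δ ⊢ ∀' s φ
    ∀E    : ∀ {Γ Δ s φ} → T ∣ Γ ∣ Δ ⊢ ∀' s φ → (t : Term Γ s) → T ∣ Γ ∣ Δ ⊢ (φ [ t ])
    ∃I    : ∀ {Γ Δ s φ} (t : Term Γ s) → T ∣ Γ ∣ Δ ⊢ (φ [ t ]) → T ∣ Γ ∣ Δ ⊢ ∃' s φ
    ∃E    : ∀ {Γ Δ s φ ψ} → T ∣ Γ ∣ Δ ⊢ ∃' s φ → T ∣ (s ∷ Γ) ∣ (φ ∷ map wk Δ) ⊢ wk ψ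
            → T ∣ Γ ∣ Δ ⊢ ψ
    ≐refl : ∀ {Γ Δ s} (t : Term Γ s) → T ∣ Γ ∣ Δ ⊢ (t ≐ t)
    ≐subst : ∀ {Γ Δ s} (φ : Formula (s ∷ Γ)) {t u : Term Γ s}
             → T ∣ Γ ∣ Δ ⊢ (t ≐ u) → T ∣ Γ ∣ Δ ⊢ (φ [ t ]) → T ∣ Γ ∣ Δ ⊢ (φ [ u ])

  _⊢_ : Theory → Formula [] → Set
  T ⊢ ψ = T ∣ [] ∣ [] ⊢ ψ

  _⊢ᵀ_ : Theory → Theory → Set
  T ⊢ᵀ U = ∀ ψ → U ψ → T ⊢ ψ

{-# OPTIONS --safe #-}
module Submission where

-- Double induction on φ(X, Y) is single induction on X for ∀Y φ(X, Y), a ∀₁ formula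
-- when φ is open. Its base ∀Y φ(nil, Y) is a premise. For the step, assume ∀Y φ(X, Y)
-- and split an arbitrary Y with CA: φ(x ∷ X, nil) is a premise, and φ(x ∷ X, y ∷ Y′)
-- follows from φ(X, Y′) by the double-induction step.

open import Defs
open import Data.List using (List; []; _∷_; map)
open import Data.List.Relation.Unary.Any using (here; there)
open import Data.Sum using (inj₁; inj₂)
open import Data.Product using (_,_)
open import Relation.Binary.PropositionalEquality
  using (_≡_; refl; sym; trans; cong; cong₂; subst; module ≡-Reasoning)

module Substitution (L : Language) where
  open Language L
  open FOL L

  infix 4 _≗ₛ_
  _≗ₛ_ : ∀ {Γ Δ} → Sub Γ Δ → Sub Γ Δ → Set
  σ ≗ₛ τ = ∀ {s} (v : Var _ s) → σ v ≡ τ v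

  mutual
    renT-as-subT : ∀ {Γ Δ s} (ρ : Ren Γ Δ) (t : Term Γ s) → renT ρ t ≡ subT (λ v → var (ρ v)) t
    renT-as-subT ρ (var v)    = refl
    renT-as-subT ρ (app f ts) = cong (app f) (renTs-as-subTs ρ ts)

    renTs-as-subTs : ∀ {Γ Δ ss} (ρ : Ren Γ Δ) (ts : Terms Γ ss)
                   → renTs ρ ts ≡ subTs (λ v → var (ρ v)) ts
    renTs-as-subTs ρ []ₜ       = refl
    renTs-as-subTs ρ (t ∷ₜ ts) = cong₂ _∷ₜ_ (renT-as-subT ρ t) (renTs-as-subTs ρ ts)

  mutual
    subT-subT : ∀ {Γ Δ Θ s} {σ : Sub Δ Θ} {τ : Sub Γ Δ} {υ : Sub Γ Θ}
              → (λ v → subT σ (τ v)) ≗ₛ υ → (t : Term Γ s) → subT σ (subT τ t) ≡ subT υ t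
    subT-subT h (var v)    = h v
    subT-subT h (app f ts) = cong (app f) (subTs-subTs h ts)

    subTs-subTs : ∀ {Γ Δ Θ ss} {σ : Sub Δ Θ} {τ : Sub Γ Δ} {υ : Sub Γ Θ}
                → (λ v → subT σ (τ v)) ≗ₛ υ → (ts : Terms Γ ss) → subTs σ (subTs τ ts) ≡ subTs υ ts
    subTs-subTs h []ₜ       = refl
    subTs-subTs h (t ∷ₜ ts) = cong₂ _∷ₜ_ (subT-subT h t) (subTs-subTs h ts)

  mutual
    subT-var : ∀ {Γ s} (t : Term Γ s) → subT var t ≡ t
    subT-var (var v)    = refl
    subT-var (app f ts) = cong (app f) (subTs-var ts)

    subTs-var : ∀ {Γ ss} (ts : Terms Γ ss) → subTs var ts ≡ ts
    subTs-var []ₜ       = refl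
    subTs-var (t ∷ₜ ts) = cong₂ _∷ₜ_ (subT-var t) (subTs-var ts)

  subT-cong : ∀ {Γ Δ s} {σ τ : Sub Γ Δ} → σ ≗ₛ τ → (t : Term Γ s) → subT σ t ≡ subT τ t
  subT-cong {σ = σ} h t = trans (cong (subT σ) (sym (subT-var t))) (subT-subT h t)

  subTs-cong : ∀ {Γ Δ ss} {σ τ : Sub Γ Δ} → σ ≗ₛ τ → (ts : Terms Γ ss) → subTs σ ts ≡ subTs τ ts
  subTs-cong {σ = σ} h ts = trans (cong (subTs σ) (sym (subTs-var ts))) (subTs-subTs h ts)

  subT-liftS-wk : ∀ {Γ Δ r s} (σ : Sub Γ Δ) (t : Term Γ s)
                → subT (liftS {r = r} σ) (renT there t) ≡ renT there (subT σ t)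
  subT-liftS-wk σ t = begin
    subT (liftS σ) (renT there t)                  ≡⟨ cong (subT (liftS σ)) (renT-as-subT there t) ⟩
    subT (liftS σ) (subT (λ v → var (there v)) t)  ≡⟨ subT-subT (λ v → renT-as-subT there (σ v)) t ⟩
    subT (λ v → subT (λ w → var (there w)) (σ v)) t ≡⟨ sym (subT-subT (λ v → refl) t) ⟩
    subT (λ w → var (there w)) (subT σ t)          ≡⟨ sym (renT-as-subT there (subT σ t)) ⟩
    renT there (subT σ t)                          ∎
    where open ≡-Reasoning

  subT-sub0-wk : ∀ {Γ s r} (u : Term Γ r) (t : Term Γ s) → subT (sub0 u) (renT there t) ≡ t
  subT-sub0-wk u t =
    trans (cong (subT (sub0 u)) (renT-as-subT there t)) (trans (subT-subT (λ v → refl) t) (subT-var t))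

  liftR≗liftS : ∀ {Γ Δ r} {ρ : Ren Γ Δ} {σ : Sub Γ Δ} → (λ v → var (ρ v)) ≗ₛ σ
              → (λ v → var (liftR {r = r} ρ v)) ≗ₛ liftS σ
  liftR≗liftS h here      = refl
  liftR≗liftS h (there v) = cong (renT there) (h v)

  liftS-subT : ∀ {Γ Δ Θ r} {σ : Sub Δ Θ} {τ : Sub Γ Δ} {υ : Sub Γ Θ} → (λ v → subT σ (τ v)) ≗ₛ υ
             → (λ v → subT (liftS σ) (liftS {r = r} τ v)) ≗ₛ liftS υ
  liftS-subT h here                = refl
  liftS-subT {σ = σ} {τ} h (there v) = trans (subT-liftS-wk σ (τ v)) (cong (renT there) (h v))

  liftS-var : ∀ {Γ r} {σ : Sub Γ Γ} → σ ≗ₛ var → liftS {r = r} σ ≗ₛ var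
  liftS-var h here      = refl
  liftS-var h (there v) = cong (renT there) (h v)

  renF-as-subF : ∀ {Γ Δ} {ρ : Ren Γ Δ} {σ : Sub Γ Δ} → (λ v → var (ρ v)) ≗ₛ σ
               → (φ : Formula Γ) → renF ρ φ ≡ subF σ φ
  renF-as-subF h ⊥'         = refl
  renF-as-subF h (rel R ts) = cong (rel R) (trans (renTs-as-subTs _ ts) (subTs-cong h ts))
  renF-as-subF h (t ≐ u)    =
    cong₂ _≐_ (trans (renT-as-subT _ t) (subT-cong h t)) (trans (renT-as-subT _ u) (subT-cong h u))
  renF-as-subF h (φ ⇒ ψ)    = cong₂ _⇒_ (renF-as-subF h φ) (renF-as-subF h ψ)
  renF-as-subF h (φ ∧' ψ)   = cong₂ _∧'_ (renF-as-subF h φ) (renF-as-subF h ψ)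
  renF-as-subF h (φ ∨' ψ)   = cong₂ _∨'_ (renF-as-subF h φ) (renF-as-subF h ψ)
  renF-as-subF h (∀' s φ)   = cong (∀' s) (renF-as-subF (liftR≗liftS h) φ)
  renF-as-subF h (∃' s φ)   = cong (∃' s) (renF-as-subF (liftR≗liftS h) φ)

  subF-subF : ∀ {Γ Δ Θ} {σ : Sub Δ Θ} {τ : Sub Γ Δ} {υ : Sub Γ Θ} → (λ v → subT σ (τ v)) ≗ₛ υ
            → (φ : Formula Γ) → subF σ (subF τ φ) ≡ subF υ φ
  subF-subF h ⊥'         = refl
  subF-subF h (rel R ts) = cong (rel R) (subTs-subTs h ts)
  subF-subF h (t ≐ u)    = cong₂ _≐_ (subT-subT h t) (subT-subT h u)
  subF-subF h (φ ⇒ ψ)    = cong₂ _⇒_ (subF-subF h φ) (subF-subF h ψ)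
  subF-subF h (φ ∧' ψ)   = cong₂ _∧'_ (subF-subF h φ) (subF-subF h ψ)
  subF-subF h (φ ∨' ψ)   = cong₂ _∨'_ (subF-subF h φ) (subF-subF h ψ)
  subF-subF h (∀' s φ)   = cong (∀' s) (subF-subF (liftS-subT h) φ)
  subF-subF h (∃' s φ)   = cong (∃' s) (subF-subF (liftS-subT h) φ)

  subF-id : ∀ {Γ} {σ : Sub Γ Γ} → σ ≗ₛ var → (φ : Formula Γ) → subF σ φ ≡ φ
  subF-id h ⊥'         = refl
  subF-id h (rel R ts) = cong (rel R) (trans (subTs-cong h ts) (subTs-var ts))
  subF-id h (t ≐ u)    = cong₂ _≐_ (trans (subT-cong h t) (subT-var t)) (trans (subT-cong h u) (subT-var u))
  subF-id h (φ ⇒ ψ)    = cong₂ _⇒_ (subF-id h φ) (subF-id h ψ)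
  subF-id h (φ ∧' ψ)   = cong₂ _∧'_ (subF-id h φ) (subF-id h ψ)
  subF-id h (φ ∨' ψ)   = cong₂ _∨'_ (subF-id h φ) (subF-id h ψ)
  subF-id h (∀' s φ)   = cong (∀' s) (subF-id (liftS-var h) φ)
  subF-id h (∃' s φ)   = cong (∃' s) (subF-id (liftS-var h) φ)

  subF-cong : ∀ {Γ Δ} {σ τ : Sub Γ Δ} → σ ≗ₛ τ → (φ : Formula Γ) → subF σ φ ≡ subF τ φ
  subF-cong {σ = σ} h φ = trans (cong (subF σ) (sym (subF-id (λ v → refl) φ))) (subF-subF h φ)

  -- Formulas produced by weakening and instantiation are compared by normalising
  -- both to substitution instances of one formula and comparing the substitutions
  -- variable by variable, where they agree by computation.
  infix 4 _≅_⟪_⟫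
  _≅_⟪_⟫ : ∀ {Γ Δ} → Formula Δ → Formula Γ → Sub Γ Δ → Set
  A ≅ φ ⟪ σ ⟫ = A ≡ subF σ φ

  renF-⟪⟫ : ∀ {Γ Δ} (ρ : Ren Γ Δ) (φ : Formula Γ) → renF ρ φ ≅ φ ⟪ (λ v → var (ρ v)) ⟫
  renF-⟪⟫ ρ = renF-as-subF (λ v → refl)

  ⟪⟫-renF : ∀ {Γ Δ Θ} {φ : Formula Γ} {σ : Sub Γ Δ} {A : Formula Δ} (ρ : Ren Δ Θ)
          → A ≅ φ ⟪ σ ⟫ → renF ρ A ≅ φ ⟪ (λ v → renT ρ (σ v)) ⟫
  ⟪⟫-renF {φ = φ} {σ} ρ refl =
    trans (renF-⟪⟫ ρ (subF σ φ)) (subF-subF (λ v → sym (renT-as-subT ρ (σ v))) φ)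

  ⟪⟫-subF : ∀ {Γ Δ Θ} {φ : Formula Γ} {σ : Sub Γ Δ} {A : Formula Δ} (τ : Sub Δ Θ)
          → A ≅ φ ⟪ σ ⟫ → subF τ A ≅ φ ⟪ (λ v → subT τ (σ v)) ⟫
  ⟪⟫-subF {φ = φ} τ refl = subF-subF (λ v → refl) φ

  same-instance : ∀ {Γ Δ} {φ : Formula Γ} {σ τ : Sub Γ Δ} {A B : Formula Δ}
                → A ≅ φ ⟪ σ ⟫ → B ≅ φ ⟪ τ ⟫ → σ ≗ₛ τ → A ≡ B
  same-instance {φ = φ} A≅ B≅ σ≗τ = trans A≅ (trans (subF-cong σ≗τ φ) (sym B≅))

  renF-liftR-sub0-var : ∀ {Γ s} (φ : Formula (s ∷ Γ)) → renF (liftR there) φ [ var here ] ≡ φ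
  renF-liftR-sub0-var φ =
    trans (⟪⟫-subF (sub0 (var here)) (renF-⟪⟫ (liftR there) φ))
          (subF-id (λ { here → refl ; (there v) → refl }) φ)

  fromClosed-id : (χ : Formula []) → fromClosed χ ≡ χ
  fromClosed-id χ = trans (renF-as-subF {σ = var} (λ ()) χ) (subF-id (λ ()) χ)

module Derivations (L : Language) (T : FOL.Theory L) where
  open Language L
  open FOL L
  open Substitution L

  cast : ∀ {Γ Δ A B} → A ≡ B → T ∣ Γ ∣ Δ ⊢ A → T ∣ Γ ∣ Δ ⊢ B
  cast {Γ} {Δ} = subst (T ∣ Γ ∣ Δ ⊢_)

  ≐-sym : ∀ {Γ Δ s} {t u : Term Γ s} → T ∣ Γ ∣ Δ ⊢ (t ≐ u) → T ∣ Γ ∣ Δ ⊢ (u ≐ t)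
  ≐-sym {t = t} {u} t≐u =
    cast (cong (u ≐_) (subT-sub0-wk u t))
      (≐subst (var here ≐ renT there t) t≐u (cast (cong (t ≐_) (sym (subT-sub0-wk t t))) (≐refl t)))

  close-⇒ : ∀ Γ {A B : Formula Γ} → (∀ Δ → T ∣ Γ ∣ Δ ⊢ (A ⇒ B)) → T ⊢ (close Γ A ⇒ close Γ B)
  close-⇒ []      A⇒B = A⇒B []
  close-⇒ (s ∷ Γ) {A} A⇒B = close-⇒ Γ λ Δ →
    ⇒I (∀I (⇒E (A⇒B _) (cast (renF-liftR-sub0-var A) (∀E (hyp (here refl)) (var here)))))

module DoubleInduction (L : Language) (T : FOL.Theory L) (ca : T (FOL.CA L)) where
  open Language L
  open FOL L
  open Substitution L
  open Derivations L T

  list-cases : ∀ {Γ Δ} (χ : Formula (𝕃 ∷ Γ))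
             → T ∣ Γ ∣ Δ ⊢ ((χ [ nilT ] ∧' ∀' 𝕃 (∀' ι (subF σcons χ))) ⇒ ∀' 𝕃 χ)
  list-cases {Γ} {Δ} χ = ⇒I (∀I (∨E (∀E (ax ca) (var here)) nil-case cons-case))
    where
    H : Formula Γ
    H = χ [ nilT ] ∧' ∀' 𝕃 (∀' ι (subF σcons χ))

    nil-case : T ∣ 𝕃 ∷ Γ ∣ (var here ≐ nilT) ∷ map wk (H ∷ Δ) ⊢ χ
    nil-case = cast (renF-liftR-sub0-var χ)
      (≐subst (renF (liftR there) χ) (≐-sym (hyp (here refl)))
        (cast (same-instance (⟪⟫-renF there refl) (⟪⟫-subF _ (renF-⟪⟫ _ χ))
                             (λ { here → refl ; (there v) → refl }))
              (∧E₁ (hyp (there (here refl))))))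

    cons-case : T ∣ 𝕃 ∷ Γ ∣ ∃' 𝕃 (∃' ι (var (there (there here)) ≐ consT (var here) (var (there here))))
                              ∷ map wk (H ∷ Δ) ⊢ χ
    cons-case = ∃E (hyp (here refl)) (∃E (hyp (here refl))
      (cast (same-instance (⟪⟫-subF _ (renF-⟪⟫ _ χ))
                           (⟪⟫-renF there (renF-⟪⟫ _ χ))
                           (λ { here → refl ; (there v) → refl }))
        (≐subst (renF (liftR (λ v → there (there (there v)))) χ) (≐-sym (hyp (here refl)))
          (cast (same-instance (⟪⟫-subF _ (⟪⟫-subF _ (⟪⟫-renF _ (⟪⟫-renF _ (⟪⟫-renF _ refl)))))
                               (⟪⟫-subF _ (renF-⟪⟫ _ χ))
                               (λ { here → refl ; (there v) → refl }))
                (∀E (∀E (∧E₂ (hyp (there (there (there (here refl)))))) (var (there here))) (var here))))))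

  Premises₂ : ∀ {Γ} → Formula (𝕃 ∷ 𝕃 ∷ Γ) → Formula Γ
  Premises₂ φ = ∀' 𝕃 (subF σYnil φ) ∧' ∀' 𝕃 (subF σXnil φ)
                ∧' ∀' 𝕃 (∀' 𝕃 (∀' ι (∀' ι (renF ρXY φ ⇒ subF σconsXY φ))))

  ⟨_∣_,_⟩ : ∀ {Γ Θ} → Ren Γ Θ → Term Θ 𝕃 → Term Θ 𝕃 → Sub (𝕃 ∷ 𝕃 ∷ Γ) Θ
  ⟨ ρ ∣ X , Y ⟩ here              = Y
  ⟨ ρ ∣ X , Y ⟩ (there here)      = X
  ⟨ ρ ∣ X , Y ⟩ (there (there v)) = var (ρ v)

  premises₂⇒base : ∀ {Γ Δ} (φ : Formula (𝕃 ∷ 𝕃 ∷ Γ)) → T ∣ Γ ∣ Δ ⊢ (Premises₂ φ ⇒ ∀' 𝕃 φ [ nilT ])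
  premises₂⇒base φ =
    ⇒I (cast (cong (∀' 𝕃) (subF-cong (λ { here → refl ; (there here) → refl ; (there (there v)) → refl }) φ))
             (∧E₁ (∧E₂ (hyp (here refl)))))

  premises₂⇒step : ∀ {Γ Δ} (φ : Formula (𝕃 ∷ 𝕃 ∷ Γ))
                 → T ∣ Γ ∣ Δ ⊢ (Premises₂ φ ⇒ ∀' 𝕃 (∀' ι (renF there (∀' 𝕃 φ) ⇒ subF σcons (∀' 𝕃 φ))))
  premises₂⇒step {Γ} {Δ} φ =
    ⇒I (∀I (∀I (⇒I (⇒E (list-cases (subF (liftS σcons) φ)) (∧I nil-case (∀I (∀I cons-case)))))))
    where
    Θ : List Sort
    Θ = ι ∷ 𝕃 ∷ ι ∷ 𝕃 ∷ Γ

    y′ x : Term Θ ι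
    y′ = var here
    x  = var (there (there here))

    Y′ X : Term Θ 𝕃
    Y′ = var (there here)
    X  = var (there (there (there here)))

    φ⟨_,_⟩ : Term Θ 𝕃 → Term Θ 𝕃 → Formula Θ
    φ⟨ U , V ⟩ = subF ⟨ (λ v → there (there (there (there v)))) ∣ U , V ⟩ φ

    Hyps : List (Formula (ι ∷ 𝕃 ∷ Γ))
    Hyps = renF there (∀' 𝕃 φ) ∷ map wk (map wk (Premises₂ φ ∷ Δ))

    nil-case : T ∣ ι ∷ 𝕃 ∷ Γ ∣ Hyps ⊢ (subF (liftS σcons) φ [ nilT ])
    nil-case = cast (same-instance (⟪⟫-subF _ (⟪⟫-renF _ (⟪⟫-renF _ refl))) (⟪⟫-subF _ refl)
                                   (λ { here → refl ; (there here) → refl ; (there (there v)) → refl }))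
                    (∀E (∧E₁ (hyp (there (here refl)))) (consT (var here) (var (there here))))

    induction-hyp : T ∣ Θ ∣ map wk (map wk Hyps) ⊢ φ⟨ X , Y′ ⟩
    induction-hyp =
      cast (same-instance (⟪⟫-subF _ (⟪⟫-renF _ (⟪⟫-renF _ (renF-⟪⟫ _ φ)))) refl
                          (λ { here → refl ; (there here) → refl ; (there (there v)) → refl }))
           (∀E (hyp (here refl)) Y′)

    premise-step : T ∣ Θ ∣ map wk (map wk Hyps) ⊢ (φ⟨ X , Y′ ⟩ ⇒ φ⟨ consT x X , consT y′ Y′ ⟩)
    premise-step =
      cast (cong₂ _⇒_
             (same-instance (⟪⟫-subF _ (⟪⟫-subF _ (⟪⟫-subF _ (⟪⟫-subF _
                               (⟪⟫-renF _ (⟪⟫-renF _ (⟪⟫-renF _ (⟪⟫-renF _ (renF-⟪⟫ _ φ)))))))))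
                            refl (λ { here → refl ; (there here) → refl ; (there (there v)) → refl }))
             (same-instance (⟪⟫-subF _ (⟪⟫-subF _ (⟪⟫-subF _ (⟪⟫-subF _
                               (⟪⟫-renF _ (⟪⟫-renF _ (⟪⟫-renF _ (⟪⟫-renF _ refl))))))))
                            refl (λ { here → refl ; (there here) → refl ; (there (there v)) → refl })))
           (∀E (∀E (∀E (∀E (∧E₂ (∧E₂ (hyp (there (here refl))))) X) Y′) x) y′)

    cons-case : T ∣ Θ ∣ map wk (map wk Hyps) ⊢ subF σcons (subF (liftS σcons) φ)
    cons-case = cast (same-instance refl (⟪⟫-subF _ refl)
                                    (λ { here → refl ; (there here) → refl ; (there (there v)) → refl }))
                     (⇒E premise-step induction-hyp)

  IX-∀⇒IXY : ∀ {Γ Δ} (φ : Formula (𝕃 ∷ 𝕃 ∷ Γ)) → T ∣ Γ ∣ Δ ⊢ (IX (∀' 𝕃 φ) ⇒ IXY φ)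
  IX-∀⇒IXY φ = ⇒I (⇒I (⇒E (hyp (there (here refl)))
    (∧I (⇒E (premises₂⇒base φ) (hyp (here refl))) (⇒E (premises₂⇒step φ) (hyp (here refl))))))

module _ (L : Language) where
  open Language L
  open FOL L
  open Substitution L

  IND₂-from-IND : {Φ Ψ : Class} → (∀ {Γ} {φ : Formula (𝕃 ∷ 𝕃 ∷ Γ)} → Φ φ → Ψ (∀' 𝕃 φ))
                → (⟨ CA ⟩ + IND Ψ) ⊢ᵀ IND₂ Φ
  IND₂-from-IND {Φ} {Ψ} ∀Φ⊆Ψ .(close Γ (IXY φ)) (Γ , φ , φ∈Φ , refl) =
    ⇒E (close-⇒ Γ λ Δ → IX-∀⇒IXY φ)
       (cast (fromClosed-id _) (ax (inj₂ (Γ , ∀' 𝕃 φ , ∀Φ⊆Ψ φ∈Φ , refl))))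
    where
    open Derivations L (⟨ CA ⟩ + IND Ψ)
    open DoubleInduction L (⟨ CA ⟩ + IND Ψ) (inj₁ refl)

lemma4p5 : (L : Language) →
    let open FOL L in
      (⟨ CA ⟩ + IND IsForall₁) ⊢ᵀ IND₂ IsOpen
lemma4p5 L = IND₂-from-IND L {IsOpen} {IsForall₁} λ φ-open → all (open' φ-open)
  where open FOL L
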